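{- Let $\ell,m,n\ge 1$ and $P=[\ell]\times[m]\times[n]$. For an integer $t$ let $c_t$ be the product of the toggles of all $(i,j,k)\in P$ with $i-j+k=t$, and let $\mathrm{pro}=c_{\ell+n-1}\circ\cdots\circ c_{3-m}\circ c_{2-m}$ (so the column with smallest value of $i-j+k$ is toggled first). Then there is a bijection $\Phi:J(P)\to J(P)$ with $\Phi\circ\mathrm{row}=\mathrm{pro}\circ\Phi$.
   Context: $[a]$ is the $a$-element chain and $P$ is the product poset with componentwise order; $J(P)$ is its set of order ideals (plane partitions in an $\ell\times m\times n$ box). Toggle $t_p$: $t_p(I)=I\cup\{p\}$ if $p\notin I$ and all $p'<p$ lie in $I$; $t_p(I)=I\setminus\{p\}$ if $p\in I$ and no $p'>p$ lies in $I$; $t_p(I)=I$ otherwise. Elements with equal $i-j+k$ are pairwise non-covering, so $c_t$ is well defined. Rowmotion: $\mathrm{row}(I)$ is the order ideal generated by the minimal elements of $P\setminus I$. -}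

module Defs where

open import Data.Bool using (Bool; true; false; T; not; _∧_; _∨_; if_then_else_)
open import Data.Nat using (ℕ; zero; suc; _+_; _∸_)
open import Data.Fin using (Fin; toℕ)
import Data.Fin as F
open import Data.Integer using (ℤ; +_; _-_) renaming (_+_ to _+ℤ_)
import Data.Integer as Z
open import Data.List using (List; allFin; map; filter; foldl; concatMap)
open import Data.Bool.ListAction using (and; or)
open import Data.Vec using (Vec; lookup; _[_]≔_)
open import Data.Product using (_×_; _,_)
open import Relation.Nullary.Decidable using (⌊_⌋)
open import Relation.Binary.PropositionalEquality using (_≡_)

-- A subset of P = [ℓ]×[m]×[n], as a nested Boolean vector (Fin indices are 0-based:
-- the Fin triple (i₀,j₀,k₀) stands for the element (i₀+1, j₀+1, k₀+1) of P).
Sub : ℕ → ℕ → ℕ → Set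
Sub ℓ m n = Vec (Vec (Vec Bool n) m) ℓ

Pt : ℕ → ℕ → ℕ → Set
Pt ℓ m n = Fin ℓ × Fin m × Fin n

module _ {ℓ m n : ℕ} where

  mem : Sub ℓ m n → Pt ℓ m n → Bool
  mem S (i , j , k) = lookup (lookup (lookup S i) j) k

  setAt : Sub ℓ m n → Pt ℓ m n → Bool → Sub ℓ m n
  setAt S (i , j , k) b =
    S [ i ]≔ (lookup S i [ j ]≔ (lookup (lookup S i) j [ k ]≔ b))

  points : List (Pt ℓ m n)
  points = concatMap (λ i → concatMap (λ j → map (λ k → (i , j , k)) (allFin n)) (allFin m)) (allFin ℓ)

  allP : (Pt ℓ m n → Bool) → Bool
  allP f = and (map f points)

  anyP : (Pt ℓ m n → Bool) → Bool
  anyP f = or (map f points)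

  _≤ᵇ_ : Pt ℓ m n → Pt ℓ m n → Bool
  (i , j , k) ≤ᵇ (i' , j' , k') = ⌊ i F.≤? i' ⌋ ∧ ⌊ j F.≤? j' ⌋ ∧ ⌊ k F.≤? k' ⌋

  _≟ᵇ_ : Pt ℓ m n → Pt ℓ m n → Bool
  (i , j , k) ≟ᵇ (i' , j' , k') = ⌊ i F.≟ i' ⌋ ∧ ⌊ j F.≟ j' ⌋ ∧ ⌊ k F.≟ k' ⌋

  _<ᵇ_ : Pt ℓ m n → Pt ℓ m n → Bool
  p <ᵇ q = (p ≤ᵇ q) ∧ not (p ≟ᵇ q)

  _≤P_ : Pt ℓ m n → Pt ℓ m n → Set
  p ≤P q = T (p ≤ᵇ q)

  IsIdeal : Sub ℓ m n → Set
  IsIdeal S = ∀ p q → p ≤P q → T (mem S q) → T (mem S p)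

  toggle : Pt ℓ m n → Sub ℓ m n → Sub ℓ m n
  toggle p S =
    if mem S p
    then (if allP (λ q → not (p <ᵇ q) ∨ not (mem S q)) then setAt S p false else S)
    else (if allP (λ q → not (q <ᵇ p) ∨ mem S q) then setAt S p true else S)

  label : Pt ℓ m n → ℤ
  label (i , j , k) = (+ suc (toℕ i)) - (+ suc (toℕ j)) +ℤ (+ suc (toℕ k))

  col : ℤ → Sub ℓ m n → Sub ℓ m n
  col t S = foldl (λ S' p → toggle p S') S (filter (λ p → label p Z.≟ t) points)

  proAux : ℕ → ℤ → Sub ℓ m n → Sub ℓ m n
  proAux zero    t S = S
  proAux (suc r) t S = proAux r (t +ℤ + 1) (col t S)

  -- pro = c_{ℓ+n-1} ∘ ⋯ ∘ c_{3-m} ∘ c_{2-m}  (there are ℓ+m+n-2 columns)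
  pro : Sub ℓ m n → Sub ℓ m n
  pro = proAux (ℓ + m + n ∸ 2) ((+ 2) - (+ m))

  minCompl : Sub ℓ m n → Pt ℓ m n → Bool
  minCompl S q = not (mem S q) ∧ allP (λ p → not (p <ᵇ q) ∨ mem S p)

  row : Sub ℓ m n → Sub ℓ m n
  row S = build
    where
    build : Sub ℓ m n
    build = Data.Vec.tabulate λ i → Data.Vec.tabulate λ j → Data.Vec.tabulate λ k →
      anyP (λ q → minCompl S q ∧ ((i , j , k) ≤ᵇ q))

module Submission where

-- Rowmotion and promotion are both products of all the toggles, taken in different orders:
-- rowmotion toggles from the top down, promotion column by column. On order ideals, toggles of
-- points that do not cover one another commute, so such a product only depends on the relative
-- order of covering pairs, which we prescribe by an integer key. The keys key s, s = 0, …, ℓ + n,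
-- interpolate between the two orders, and the words for key s and key (s + 1) differ by moving
-- the toggles of the points with (0-based) x + z > s from the front of the word to its back.
-- Each step is therefore a conjugation, and Φ is the product of the conjugating toggles.

open import Defs

open import Data.Bool using (Bool; true; false; T; not; _∧_; _∨_; if_then_else_)
import Data.Bool.Properties as Bool
open import Data.Bool.ListAction using (and)
open import Data.Empty using (⊥; ⊥-elim)
open import Data.Fin as F using (Fin; toℕ)
import Data.Fin.Properties as Fin
open import Data.Integer as ℤ using (ℤ; +_; _⊖_) renaming (_+_ to _+ℤ_; _<_ to _<ℤ_; _≤_ to _≤ℤ_)
import Data.Integer.Properties as ℤ
open import Data.List using (List; []; _∷_; _++_; map; filter; foldl; concatMap; reverse; allFin)
import Data.List.Properties as List
open import Data.List.Membership.Propositional using (_∈_; _∉_; find; lose)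
open import Data.List.Membership.Propositional.Properties
  using (∈-++⁺ˡ; ∈-++⁺ʳ; ∈-++⁻; ∈-∃++; ∈-concatMap⁺; ∈-concatMap⁻; ∈-map⁺; ∈-map⁻; ∈-filter⁺; ∈-filter⁻; ∈-allFin)
open import Data.List.Relation.Binary.Subset.Propositional using (_⊆_)
open import Data.List.Relation.Unary.All as All using (All; []; _∷_)
import Data.List.Relation.Unary.All.Properties as All
open import Data.List.Relation.Unary.AllPairs as AllPairs using (AllPairs; []; _∷_)
import Data.List.Relation.Unary.AllPairs.Properties as AllPairs
open import Data.List.Relation.Unary.Any using (here; there)
import Data.List.Relation.Unary.Any.Properties as Any
open import Data.List.Relation.Unary.Unique.Propositional using (Unique)
import Data.List.Relation.Unary.Unique.Propositional.Properties as Unique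
open import Data.Nat using (ℕ; zero; suc; _≤_; _<_; _+_; _*_; _⊓_; _∸_; s≤s; z≤n)
import Data.Nat.Properties as Nat
open import Data.Nat.Tactic.RingSolver using (solve-∀)
open import Data.Product using (Σ; ∃; _×_; _,_; proj₁; proj₂)
import Data.Product.Properties as ×
open import Data.Sum using (_⊎_; inj₁; inj₂)
import Data.Sum as Sum
open import Data.Vec using (Vec; lookup; _[_]≔_; tabulate)
open import Data.Vec.Properties using (lookup∘update; lookup∘update′; lookup∘tabulate; tabulate∘lookup; tabulate-cong)
open import Function using (_∘_; Equivalence; case_of_)
open import Relation.Binary.Definitions using (DecidableEquality)
import Relation.Binary.Construct.NonStrictToStrict as Strict
import Relation.Binary.PropositionalEquality as ≡
open import Relation.Binary.PropositionalEquality using (_≡_; _≢_; refl; sym; trans; cong; cong₂; subst; subst₂)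
open import Relation.Nullary using (¬_; Dec; yes; no)
import Relation.Nullary.Decidable as Dec
open import Relation.Nullary.Decidable using (T?)

T-ext : ∀ {a b} → (T a → T b) → (T b → T a) → a ≡ b
T-ext {false} {false} _ _ = refl
T-ext {false} {true}  _ g = ⊥-elim (g _)
T-ext {true}  {false} f _ = ⊥-elim (f _)
T-ext {true}  {true}  _ _ = refl

T-ext-not : ∀ {a b} → (T a → ¬ T b) → (¬ T a → T b) → a ≡ not b
T-ext-not {false} {false} _ g = ⊥-elim (g λ ())
T-ext-not {false} {true}  _ _ = refl
T-ext-not {true}  {false} _ _ = refl
T-ext-not {true}  {true}  f _ = ⊥-elim (f _ _)

¬T⇒≡false : ∀ {b} → ¬ T b → b ≡ false
¬T⇒≡false {false} _ = refl
¬T⇒≡false {true}  f = ⊥-elim (f _)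

T⇒≡true : ∀ {b} → T b → b ≡ true
T⇒≡true {true} _ = refl

T-not⁺ : ∀ {b} → T (not b) → ¬ T b
T-not⁺ {false} _ ()

T-not⁻ : ∀ {b} → ¬ T b → T (not b)
T-not⁻ {false} _ = _
T-not⁻ {true}  f = f _

T-⇒⁺ : ∀ {a b} → T (not a ∨ b) → T a → T b
T-⇒⁺ {true} tb _ = tb

T-⇒⁻ : ∀ {a b} → (T a → T b) → T (not a ∨ b)
T-⇒⁻ {false} _ = _
T-⇒⁻ {true}  f = f _

⇒-cong : ∀ a {b c} → (T a → b ≡ c) → (not a ∨ b) ≡ (not a ∨ c)
⇒-cong false _ = refl
⇒-cong true  f = f _

if-twice : ∀ b r a → (T b → T a) → (¬ T b → T r) →
  (if (if b then not r else a) then not r else a) ≡ b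
if-twice true  true  true  _  _  = refl
if-twice true  true  false ba _  = ⊥-elim (ba _)
if-twice true  false _     _  _  = refl
if-twice false true  true  _  _  = refl
if-twice false _     false _  _  = refl
if-twice false false true  _  br = ⊥-elim (br λ ())

module _ {A : Set} where

  Unique-concatMap⁺ : {B : Set} {xs : List A} (f : A → List B) (g : B → A) →
    (∀ x {v} → v ∈ f x → g v ≡ x) → (∀ x → Unique (f x)) → Unique xs → Unique (concatMap f xs)
  Unique-concatMap⁺ f g g∘f f! [] = []
  Unique-concatMap⁺ {xs = x ∷ xs} f g g∘f f! (x∉ ∷ xs!) =
    Unique.++⁺ (f! x) (Unique-concatMap⁺ f g g∘f f! xs!) disjoint
    where
    disjoint : ∀ {v} → v ∈ f x × v ∈ concatMap f xs → ⊥
    disjoint (v∈fx , v∈rest) with find (∈-concatMap⁻ f v∈rest)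
    ... | y , y∈xs , v∈fy = All.lookup x∉ y∈xs (trans (sym (g∘f x v∈fx)) (g∘f y v∈fy))

  module _ {R : A → A → Set} {a : A} {zs : List A} where

    AllPairs-removeMiddle : ∀ ys → AllPairs R (ys ++ a ∷ zs) → AllPairs R (ys ++ zs)
    AllPairs-removeMiddle []       (_ ∷ rzs)  = rzs
    AllPairs-removeMiddle (y ∷ ys) (ry ∷ rys)
      with ry-ys , _ ∷ ry-zs ← All.++⁻ ys ry = All.++⁺ ry-ys ry-zs ∷ AllPairs-removeMiddle ys rys

    AllPairs-beforeMiddle : ∀ ys → AllPairs R (ys ++ a ∷ zs) → All (λ y → R y a) ys
    AllPairs-beforeMiddle []       _          = []
    AllPairs-beforeMiddle (y ∷ ys) (ry ∷ rys) =
      All.lookup ry (∈-++⁺ʳ ys (here refl)) ∷ AllPairs-beforeMiddle ys rys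

  Unique-middle-∉ : ∀ {a : A} {zs} ys → Unique (ys ++ a ∷ zs) → a ∉ ys ++ zs
  Unique-middle-∉ []       (a∉zs ∷ _) a∈zs       = All.lookup a∉zs a∈zs refl
  Unique-middle-∉ (y ∷ ys) (y∉ ∷ _)   (here refl) = All.lookup y∉ (∈-++⁺ʳ ys (here refl)) refl
  Unique-middle-∉ (y ∷ ys) (_ ∷ u)    (there a∈) = Unique-middle-∉ ys u a∈

  ∈-++-insert : ∀ {a b : A} {zs} ys → b ∈ ys ++ zs → b ∈ ys ++ a ∷ zs
  ∈-++-insert ys b∈ with ∈-++⁻ ys b∈
  ... | inj₁ b∈ys = ∈-++⁺ˡ b∈ys
  ... | inj₂ b∈zs = ∈-++⁺ʳ ys (there b∈zs)

  AllPairs-fromAll : {P : A → Set} {R : A → A → Set} {xs : List A} →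
    (∀ {a b} → P a → P b → R a b) → All P xs → AllPairs R xs
  AllPairs-fromAll f []         = []
  AllPairs-fromAll f (pa ∷ pxs) = All.map (f pa) pxs ∷ AllPairs-fromAll f pxs

  AllPairs-mapWithin : {P : A → Set} {R R′ : A → A → Set} {xs : List A} →
    (∀ {a b} → P a → P b → R a b → R′ a b) → All P xs → AllPairs R xs → AllPairs R′ xs
  AllPairs-mapWithin f []         []         = []
  AllPairs-mapWithin f (pa ∷ pxs) (ra ∷ rxs) =
    All.zipWith (λ (pb , r) → f pa pb r) (pxs , ra) ∷ AllPairs-mapWithin f pxs rxs

Vec-ext : ∀ {A : Set} {k} {xs ys : Vec A k} → (∀ i → lookup xs i ≡ lookup ys i) → xs ≡ ys
Vec-ext {xs = xs} {ys} h = begin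
  xs                  ≡⟨ tabulate∘lookup xs ⟨
  tabulate (lookup xs) ≡⟨ tabulate-cong h ⟩
  tabulate (lookup ys) ≡⟨ tabulate∘lookup ys ⟩
  ys                  ∎
  where open ≡.≡-Reasoning

module _ {b : ℕ} {i i′ : Fin b} where

  ≤-step : toℕ i′ ≡ suc (toℕ i) → i F.≤ i′
  ≤-step e = Nat.≤-trans (Nat.n≤1+n _) (Nat.≤-reflexive (sym e))

  ≢-step : toℕ i′ ≡ suc (toℕ i) → i ≢ i′
  ≢-step e i≡i′ = Nat.<⇒≢ (Nat.≤-reflexive (sym e)) (cong toℕ i≡i′)

  Fin-successor : i F.< i′ → Σ (Fin b) λ i₁ → toℕ i₁ ≡ suc (toℕ i) × i₁ F.≤ i′
  Fin-successor i<i′ =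
    F.fromℕ< i+1<b , Fin.toℕ-fromℕ< i+1<b , Nat.≤-trans (Nat.≤-reflexive (Fin.toℕ-fromℕ< i+1<b)) i<i′
    where
    i+1<b : suc (toℕ i) < b
    i+1<b = Nat.≤-<-trans i<i′ (Fin.toℕ<n i′)

-- Words of commuting involutions

module Words {A X : Set} (act : A → X → X) where

  open ≡.≡-Reasoning

  run : List A → X → X
  run w x = foldl (λ y a → act a y) x w

  run-++ : ∀ u w x → run (u ++ w) x ≡ run w (run u x)
  run-++ u w x = List.foldl-++ (λ y a → act a y) x u w

  module Preserving (Inv : X → Set) (act-Inv : ∀ a {x} → Inv x → Inv (act a x)) where

    run-Inv : ∀ w {x} → Inv x → Inv (run w x)
    run-Inv []      i = i
    run-Inv (a ∷ w) i = run-Inv w (act-Inv a i)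

    module Involutive (act-invol : ∀ a {x} → Inv x → act a (act a x) ≡ x) where

      run-reverse : ∀ w {x} → Inv x → run (reverse w) (run w x) ≡ x
      run-reverse []      i = refl
      run-reverse (a ∷ w) {x} i = begin
        run (reverse (a ∷ w)) (run w (act a x))   ≡⟨ cong (λ v → run v (run w (act a x))) (List.unfold-reverse a w) ⟩
        run (reverse w ++ a ∷ []) (run w (act a x)) ≡⟨ run-++ (reverse w) (a ∷ []) _ ⟩
        act a (run (reverse w) (run w (act a x))) ≡⟨ cong (act a) (run-reverse w (act-Inv a i)) ⟩
        act a (act a x)                           ≡⟨ act-invol a i ⟩
        x                                         ∎
    
      run-injective : ∀ w {x y} → Inv x → Inv y → run w x ≡ run w y → x ≡ y
      run-injective w {x} {y} ix iy e = begin
        x                           ≡⟨ run-reverse w ix ⟨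
        run (reverse w) (run w x)   ≡⟨ cong (run (reverse w)) e ⟩
        run (reverse w) (run w y)   ≡⟨ run-reverse w iy ⟩
        y                           ∎
    
      run-surjective : ∀ w {y} → Inv y → Σ X λ x → Inv x × run w x ≡ y
      run-surjective w {y} iy =
        run (reverse w) y , run-Inv (reverse w) iy ,
        subst (λ v → run v (run (reverse w) y) ≡ y) (List.reverse-involutive w) (run-reverse (reverse w) iy)

    module Commuting (_∼_ : A → A → Set) (∼-sym : ∀ {a b} → a ∼ b → b ∼ a)
      (act-comm : ∀ {a b x} → ¬ a ∼ b → Inv x → act a (act b x) ≡ act b (act a x)) where

      OrderedBy : (A → ℤ) → List A → Set
      OrderedBy K = AllPairs (λ a b → a ∼ b → K a <ℤ K b)

      sorted⇒orderedBy : ∀ K {w} → (∀ {a b} → a ∼ b → K a ≢ K b) →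
        AllPairs (λ a b → K a ≤ℤ K b) w → OrderedBy K w
      sorted⇒orderedBy K separated = AllPairs.map (λ ≤K a∼b → ℤ.≤∧≢⇒< ≤K (separated a∼b))

      run-act : ∀ {a} w {x} → All (λ b → ¬ a ∼ b) w → Inv x → run w (act a x) ≡ act a (run w x)
      run-act []      []         i = refl
      run-act (b ∷ w) (a≁b ∷ a≁w) i =
        trans (cong (run w) (sym (act-comm a≁b i))) (run-act w a≁w (act-Inv b i))

      run-reorder : ∀ K {w₁ w₂} → Unique w₁ → Unique w₂ → w₁ ⊆ w₂ → w₂ ⊆ w₁ →
        OrderedBy K w₁ → OrderedBy K w₂ → ∀ {x} → Inv x → run w₁ x ≡ run w₂ x
      run-reorder K {[]} {[]}    _ _ _ _ _ _ i = refl
      run-reorder K {[]} {_ ∷ _} _ _ _ w₂⊆[] _ _ i with () ← w₂⊆[] (here refl)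
      run-reorder K {a ∷ w₁} (a∉w₁ ∷ w₁!) w₂! w₁⊆w₂ w₂⊆w₁ (a≺w₁ ∷ o₁) o₂ {x} i
        with ys , zs , refl ← ∈-∃++ (w₁⊆w₂ (here refl)) = begin
          run w₁ (act a x)              ≡⟨ run-reorder K w₁! (AllPairs-removeMiddle ys w₂!) w₁⊆ ⊆w₁
                                            o₁ (AllPairs-removeMiddle ys o₂) (act-Inv a i) ⟩
          run (ys ++ zs) (act a x)      ≡⟨ run-++ ys zs _ ⟩
          run zs (run ys (act a x))     ≡⟨ cong (run zs) (run-act ys a≁ys i) ⟩
          run zs (act a (run ys x))     ≡⟨ run-++ ys (a ∷ zs) x ⟨
          run (ys ++ a ∷ zs) x          ∎
        where
        a∉ys++zs : a ∉ ys ++ zs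
        a∉ys++zs = Unique-middle-∉ ys w₂!
        w₁⊆ : w₁ ⊆ ys ++ zs
        w₁⊆ {b} b∈ with ∈-++⁻ ys (w₁⊆w₂ (there b∈))
        ... | inj₁ b∈ys         = ∈-++⁺ˡ b∈ys
        ... | inj₂ (here refl)  = ⊥-elim (All.lookup a∉w₁ b∈ refl)
        ... | inj₂ (there b∈zs) = ∈-++⁺ʳ ys b∈zs
        ⊆w₁ : ys ++ zs ⊆ w₁
        ⊆w₁ {b} b∈ with w₂⊆w₁ (∈-++-insert ys b∈)
        ... | here refl  = ⊥-elim (a∉ys++zs b∈)
        ... | there b∈w₁ = b∈w₁
        a≁ys : All (λ b → ¬ a ∼ b) ys
        a≁ys = All.tabulate λ {b} b∈ys a∼b →
          ℤ.<-asym (All.lookup a≺w₁ (⊆w₁ (∈-++⁺ˡ b∈ys)) a∼b)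
                   (All.lookup (AllPairs-beforeMiddle ys o₂) b∈ys (∼-sym a∼b))

module Levels {A : Set} (κ : A → ℤ) (xs : List A) where

  level : ℤ → List A
  level t = filter (λ a → κ a ℤ.≟ t) xs

  levels : ℤ → ℕ → List A
  levels t zero    = []
  levels t (suc r) = level t ++ levels (t +ℤ + 1) r

  private
    next-level : ∀ {t i} → t <ℤ i → t +ℤ + 1 ≤ℤ i
    next-level {t} t<i = subst (_≤ℤ _) (ℤ.+-comm (+ 1) t) (ℤ.i<j⇒suc[i]≤j t<i)

    level-κ : ∀ t → All (λ a → κ a ≡ t) (level t)
    level-κ t = All.all-filter (λ a → κ a ℤ.≟ t) xs

  ∈-levels⁻ : ∀ {a} t r → a ∈ levels t r → t ≤ℤ κ a
  ∈-levels⁻ t zero    ()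
  ∈-levels⁻ t (suc r) a∈ with ∈-++⁻ (level t) a∈
  ... | inj₁ a∈level = ℤ.≤-reflexive (sym (All.lookup (level-κ t) a∈level))
  ... | inj₂ a∈rest  = ℤ.≤-trans (ℤ.i≤i+j t (+ 1)) (∈-levels⁻ (t +ℤ + 1) r a∈rest)

  ∈-levels : ∀ {a} t r → a ∈ xs → t ≤ℤ κ a → κ a <ℤ t +ℤ + r → a ∈ levels t r
  ∈-levels t zero    a∈ t≤κ κ<t = ⊥-elim (ℤ.<⇒≱ (subst (_ <ℤ_) (ℤ.+-identityʳ t) κ<t) t≤κ)
  ∈-levels {a} t (suc r) a∈ t≤κ κ< with κ a ℤ.≟ t
  ... | yes κ≡t = ∈-++⁺ˡ (∈-filter⁺ (λ a → κ a ℤ.≟ t) a∈ κ≡t)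
  ... | no κ≢t  = ∈-++⁺ʳ (level t) (∈-levels (t +ℤ + 1) r a∈
    (next-level (ℤ.≤∧≢⇒< t≤κ (κ≢t ∘ sym)))
    (subst (κ a <ℤ_) (trans (cong (t +ℤ_) (ℤ.pos-+ 1 r)) (sym (ℤ.+-assoc t (+ 1) (+ r)))) κ<))

  levels-sorted : ∀ t r → AllPairs (λ a b → κ a ≤ℤ κ b) (levels t r)
  levels-sorted t zero    = []
  levels-sorted t (suc r) =
    AllPairs.++⁺ (AllPairs-fromAll (λ κa≡t κb≡t → ℤ.≤-reflexive (trans κa≡t (sym κb≡t))) (level-κ t))
      (levels-sorted (t +ℤ + 1) r)
      (All.map (λ κa≡t → All.tabulate λ b∈ →
         ℤ.≤-trans (ℤ.≤-reflexive κa≡t) (ℤ.≤-trans (ℤ.i≤i+j t (+ 1)) (∈-levels⁻ _ r b∈))) (level-κ t))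

  levels-unique : Unique xs → ∀ t r → Unique (levels t r)
  levels-unique xs! t zero    = []
  levels-unique xs! t (suc r) =
    Unique.++⁺ (Unique.filter⁺ (λ a → κ a ℤ.≟ t) xs!) (levels-unique xs! (t +ℤ + 1) r)
      λ (a∈level , a∈rest) → ℤ.<-irrefl (sym (All.lookup (level-κ t) a∈level))
        (ℤ.suc[i]≤j⇒i<j (subst (_≤ℤ _) (ℤ.+-comm t (+ 1)) (∈-levels⁻ (t +ℤ + 1) r a∈rest)))

-- Integer keys

module _ {a b c d : ℕ} where

  ⊖-<-⊖ : a + d < c + b → a ⊖ b <ℤ c ⊖ d
  ⊖-<-⊖ lt = begin-strict
    a ⊖ b             ≡⟨ ℤ.+-cancelˡ-⊖ d a b ⟨
    (d + a) ⊖ (d + b) <⟨ ℤ.⊖-monoˡ-< (d + b) (subst₂ _<_ (Nat.+-comm a d) (Nat.+-comm c b) lt) ⟩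
    (b + c) ⊖ (d + b) ≡⟨ cong ((b + c) ⊖_) (Nat.+-comm d b) ⟩
    (b + c) ⊖ (b + d) ≡⟨ ℤ.+-cancelˡ-⊖ b c d ⟩
    c ⊖ d             ∎
    where open ℤ.≤-Reasoning

  ⊖-≤-⊖ : a + d ≤ c + b → a ⊖ b ≤ℤ c ⊖ d
  ⊖-≤-⊖ le = begin
    a ⊖ b             ≡⟨ ℤ.+-cancelˡ-⊖ d a b ⟨
    (d + a) ⊖ (d + b) ≤⟨ ℤ.⊖-monoˡ-≤ (d + b) (subst₂ _≤_ (Nat.+-comm a d) (Nat.+-comm c b) le) ⟩
    (b + c) ⊖ (d + b) ≡⟨ cong ((b + c) ⊖_) (Nat.+-comm d b) ⟩
    (b + c) ⊖ (b + d) ≡⟨ ℤ.+-cancelˡ-⊖ b c d ⟩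
    c ⊖ d             ∎
    where open ℤ.≤-Reasoning

⊖-≡-⊖ : ∀ {a b c d} → a + d ≡ c + b → a ⊖ b ≡ c ⊖ d
⊖-≡-⊖ {a} {b} {c} {d} e =
  ℤ.≤-antisym (⊖-≤-⊖ {a} {b} {c} {d} (Nat.≤-reflexive e)) (⊖-≤-⊖ {c} {d} {a} {b} (Nat.≤-reflexive (sym e)))

-- The key of a point with 0-based coordinates x, y, z and h = x + z. Along a cover it moves by
-- one: up in the x- and z-directions while h < s, down otherwise. So key 0 decreases along every
-- cover (rowmotion), and key (ℓ + n) is the column label x − y + z + 1 (promotion).
keyOf : ℕ → ℕ → ℕ → ℤ
keyOf s h y = (2 * (h ⊓ s) + 1) ⊖ (h + y)

keyOf-zero : ∀ h y → keyOf 0 h y ≡ 1 ⊖ (h + y)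
keyOf-zero h y = cong (λ c → (2 * c + 1) ⊖ (h + y)) (Nat.⊓-zeroʳ h)

keyOf-suc-y : ∀ s h y → keyOf s h (suc y) <ℤ keyOf s h y
keyOf-suc-y s h y = ℤ.⊖-monoʳ->-< (2 * (h ⊓ s) + 1) (Nat.+-monoʳ-< h (Nat.n<1+n y))

keyOf-suc-h-below : ∀ {s h} y → h < s → keyOf s h y <ℤ keyOf s (suc h) y
keyOf-suc-h-below {s} {h} y h<s rewrite Nat.m≤n⇒m⊓n≡m (Nat.<⇒≤ h<s) | Nat.m≤n⇒m⊓n≡m h<s =
  ⊖-<-⊖ {2 * h + 1} {h + y} {2 * suc h + 1} {suc h + y} (Nat.≤-reflexive (arith h y))
  where
  arith : ∀ h y → suc ((2 * h + 1) + (suc h + y)) ≡ (2 * suc h + 1) + (h + y)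
  arith = solve-∀

keyOf-suc-h-above : ∀ {s h} y → s ≤ h → keyOf s (suc h) y <ℤ keyOf s h y
keyOf-suc-h-above {s} {h} y s≤h rewrite Nat.m≥n⇒m⊓n≡n s≤h | Nat.m≥n⇒m⊓n≡n (Nat.m≤n⇒m≤1+n s≤h) =
  ℤ.⊖-monoʳ->-< (2 * s + 1) (Nat.+-monoˡ-< y (Nat.n<1+n h))

keyOf-suc-s-below : ∀ {s h} y → h ≤ s → keyOf (suc s) h y ≡ keyOf s h y
keyOf-suc-s-below {s} {h} y h≤s rewrite Nat.m≤n⇒m⊓n≡m h≤s | Nat.m≤n⇒m⊓n≡m (Nat.m≤n⇒m≤1+n h≤s) = refl

keyOf-suc-s-above : ∀ {s h} y → s < h → keyOf (suc s) h y ≡ keyOf s h y +ℤ + 2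
keyOf-suc-s-above {s} {h} y s<h rewrite Nat.m≥n⇒m⊓n≡n s<h | Nat.m≥n⇒m⊓n≡n (Nat.<⇒≤ s<h) =
  trans (cong (_⊖ (h + y)) (arith s)) (sym (ℤ.distribˡ-⊖-+-pos 2 (2 * s + 1) (h + y)))
  where
  arith : ∀ s → 2 * suc s + 1 ≡ (2 * s + 1) + 2
  arith = solve-∀

keyOf-step-≢ : ∀ s {h y h′ y′} → (h′ ≡ suc h × y′ ≡ y) ⊎ (h′ ≡ h × y′ ≡ suc y) →
  keyOf s h y ≢ keyOf s h′ y′
keyOf-step-≢ s {h} {y} (inj₂ (refl , refl)) e = ℤ.<-irrefl (sym e) (keyOf-suc-y s h y)
keyOf-step-≢ s {h} {y} (inj₁ (refl , refl)) e with h Nat.<? s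
... | yes h<s = ℤ.<-irrefl e (keyOf-suc-h-below y h<s)
... | no h≮s  = ℤ.<-irrefl (sym e) (keyOf-suc-h-above y (Nat.≮⇒≥ h≮s))

module Box (ℓ m n : ℕ) where

  Point : Set
  Point = Pt ℓ m n

  Subset : Set
  Subset = Sub ℓ m n

  _≤ₚ_ : Point → Point → Set
  (i , j , k) ≤ₚ (i′ , j′ , k′) = i F.≤ i′ × j F.≤ j′ × k F.≤ k′

  ≤ₚ-refl : ∀ {p} → p ≤ₚ p
  ≤ₚ-refl = Fin.≤-refl , Fin.≤-refl , Fin.≤-refl

  ≤ₚ-trans : ∀ {p q r} → p ≤ₚ q → q ≤ₚ r → p ≤ₚ r
  ≤ₚ-trans (a , b , c) (a′ , b′ , c′) = Fin.≤-trans a a′ , Fin.≤-trans b b′ , Fin.≤-trans c c′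

  ≤ₚ-antisym : ∀ {p q} → p ≤ₚ q → q ≤ₚ p → p ≡ q
  ≤ₚ-antisym (a , b , c) (a′ , b′ , c′) =
    cong₂ _,_ (Fin.≤-antisym a a′) (cong₂ _,_ (Fin.≤-antisym b b′) (Fin.≤-antisym c c′))

  open Strict _≡_ _≤ₚ_ public using () renaming (_<_ to _<ₚ_)

  _≟ₚ_ : DecidableEquality Point
  _≟ₚ_ = ×.≡-dec F._≟_ (×.≡-dec F._≟_ F._≟_)

  ∈-points : ∀ p → p ∈ points {ℓ} {m} {n}
  ∈-points (i , j , k) =
    ∈-concatMap⁺ _ (lose (∈-allFin i) (∈-concatMap⁺ _ (lose (∈-allFin j) (∈-map⁺ _ (∈-allFin k)))))

  points-unique : Unique (points {ℓ} {m} {n})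
  points-unique = Unique-concatMap⁺ _ proj₁ first (λ i →
      Unique-concatMap⁺ _ (proj₁ ∘ proj₂) second (λ j →
        Unique.map⁺ (cong (proj₂ ∘ proj₂)) (Unique.allFin⁺ n))
      (Unique.allFin⁺ m))
    (Unique.allFin⁺ ℓ)
    where
    second : ∀ {i} j {v : Point} → v ∈ map (λ k → (i , j , k)) (allFin n) → proj₁ (proj₂ v) ≡ j
    second {i} j v∈ with _ , _ , refl ← ∈-map⁻ (λ k → (i , j , k)) v∈ = refl
    first : ∀ i {v : Point} → v ∈ concatMap (λ j → map (λ k → (i , j , k)) (allFin n)) (allFin m) → proj₁ v ≡ i
    first i v∈ with find (∈-concatMap⁻ (λ j → map (λ k → (i , j , k)) (allFin n)) {xs = allFin m} v∈)
    ... | j , _ , v∈′ with ∈-map⁻ (λ k → (i , j , k)) v∈′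
    ...   | _ , _ , refl = refl

  ≤ᵇ⇒≤ₚ : ∀ {p q : Point} → T (p ≤ᵇ q) → p ≤ₚ q
  ≤ᵇ⇒≤ₚ {i , j , k} {i′ , j′ , k′} t with i F.≤? i′ | j F.≤? j′ | k F.≤? k′
  ... | yes a | yes b | yes c = a , b , c
  ... | yes _ | yes _ | no _  = ⊥-elim t
  ... | yes _ | no _  | _     = ⊥-elim t
  ... | no _  | _     | _     = ⊥-elim t

  ≤ₚ⇒≤ᵇ : ∀ {p q : Point} → p ≤ₚ q → T (p ≤ᵇ q)
  ≤ₚ⇒≤ᵇ {i , j , k} {i′ , j′ , k′} (a , b , c) with i F.≤? i′ | j F.≤? j′ | k F.≤? k′
  ... | yes _ | yes _ | yes _ = _
  ... | yes _ | yes _ | no c≰ = c≰ c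
  ... | yes _ | no b≰ | _     = b≰ b
  ... | no a≰ | _     | _     = a≰ a

  ≟ᵇ⇒≡ : ∀ {p q : Point} → T (p ≟ᵇ q) → p ≡ q
  ≟ᵇ⇒≡ {i , j , k} {i′ , j′ , k′} t with i F.≟ i′ | j F.≟ j′ | k F.≟ k′
  ... | yes refl | yes refl | yes refl = refl
  ... | yes _    | yes _    | no _     = ⊥-elim t
  ... | yes _    | no _     | _        = ⊥-elim t
  ... | no _     | _        | _        = ⊥-elim t

  ≟ᵇ-refl : ∀ {p : Point} → T (p ≟ᵇ p)
  ≟ᵇ-refl {i , j , k} with i F.≟ i | j F.≟ j | k F.≟ k
  ... | yes _ | yes _ | yes _ = _
  ... | yes _ | yes _ | no k≢k = k≢k refl
  ... | yes _ | no j≢j | _     = j≢j refl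
  ... | no i≢i | _     | _     = i≢i refl

  <ᵇ⇒<ₚ : ∀ {p q : Point} → T (p <ᵇ q) → p <ₚ q
  <ᵇ⇒<ₚ {p} {q} t with le , ne ← Equivalence.to (Bool.T-∧ {p ≤ᵇ q}) t =
    ≤ᵇ⇒≤ₚ le , λ { refl → T-not⁺ ne (≟ᵇ-refl {p}) }

  <ₚ⇒<ᵇ : ∀ {p q : Point} → p <ₚ q → T (p <ᵇ q)
  <ₚ⇒<ᵇ (le , p≢q) = Equivalence.from Bool.T-∧ (≤ₚ⇒≤ᵇ le , T-not⁻ (p≢q ∘ ≟ᵇ⇒≡))

  _<?ₚ_ : (p q : Point) → Dec (p <ₚ q)
  p <?ₚ q = Dec.map′ <ᵇ⇒<ₚ <ₚ⇒<ᵇ (T? (p <ᵇ q))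

  allP⁺ : ∀ (f : Point → Bool) → T (allP f) → ∀ p → T (f p)
  allP⁺ f t p = All.lookup (All.all⁺ _ points t) (∈-points p)

  allP⁻ : ∀ (f : Point → Bool) → (∀ p → T (f p)) → T (allP f)
  allP⁻ f h = All.all⁻ f {xs = points} (All.tabulate λ {p} _ → h p)

  allP-cong : ∀ {f g : Point → Bool} → (∀ p → f p ≡ g p) → allP f ≡ allP g
  allP-cong f≗g = cong and (List.map-cong f≗g points)

  anyP⁺ : ∀ {f : Point → Bool} → T (anyP f) → ∃ λ p → T (f p)
  anyP⁺ t with p , _ , fp ← find (Any.any⁻ _ points t) = p , fp

  anyP⁻ : ∀ {f : Point → Bool} p → T (f p) → T (anyP f)
  anyP⁻ p fp = Any.any⁺ _ (lose (∈-points p) fp)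

  Subset-ext : ∀ {S S′ : Subset} → (∀ p → mem S p ≡ mem S′ p) → S ≡ S′
  Subset-ext h = Vec-ext λ i → Vec-ext λ j → Vec-ext λ k → h (i , j , k)

  Subset-ext-at : ∀ {S S′ : Subset} p → mem S p ≡ mem S′ p → (∀ {q} → p ≢ q → mem S q ≡ mem S′ q) →
    S ≡ S′
  Subset-ext-at p at off = Subset-ext λ q → case p ≟ₚ q of λ where
    (yes refl) → at
    (no p≢q)   → off p≢q

  mem-setAt-self : ∀ (S : Subset) p b → mem (setAt S p b) p ≡ b
  mem-setAt-self S (i , j , k) b = begin
    lookup (lookup (lookup (S [ i ]≔ _) i) j) k   ≡⟨ cong (λ v → lookup (lookup v j) k) (lookup∘update i S _) ⟩
    lookup (lookup (lookup S i [ j ]≔ _) j) k     ≡⟨ cong (λ v → lookup v k) (lookup∘update j (lookup S i) _) ⟩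
    lookup (lookup (lookup S i) j [ k ]≔ b) k     ≡⟨ lookup∘update k (lookup (lookup S i) j) b ⟩
    b                                             ∎
    where open ≡.≡-Reasoning

  mem-setAt-other : ∀ (S : Subset) {p q} b → p ≢ q → mem (setAt S p b) q ≡ mem S q
  mem-setAt-other S {i , j , k} {i′ , j′ , k′} b p≢q with i F.≟ i′ | j F.≟ j′ | k F.≟ k′
  ... | no i≢i′   | _         | _ = cong (λ v → lookup (lookup v j′) k′) (lookup∘update′ (i≢i′ ∘ sym) S _)
  ... | yes refl | no j≢j′   | _ = cong (λ v → lookup v k′)
    (trans (cong (λ v → lookup v j′) (lookup∘update i S _)) (lookup∘update′ (j≢j′ ∘ sym) (lookup S i) _))
  ... | yes refl | yes refl | no k≢k′ =
    trans (cong (λ v → lookup (lookup v j) k′) (lookup∘update i S _))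
      (trans (cong (λ v → lookup v k′) (lookup∘update j (lookup S i) _))
        (lookup∘update′ (k≢k′ ∘ sym) (lookup (lookup S i) j) b))
  ... | yes refl | yes refl | yes refl = ⊥-elim (p≢q refl)

  Ideal-down : ∀ {S : Subset} {p q} → IsIdeal S → p ≤ₚ q → T (mem S q) → T (mem S p)
  Ideal-down ideal p≤q = ideal _ _ (≤ₚ⇒≤ᵇ p≤q)

  -- Toggles

  -- canRemove and canAdd are spelled exactly as in toggle, so that toggle unfolds to them.
  canRemove : Subset → Point → Bool
  canRemove S p = allP (λ q → not (p <ᵇ q) ∨ not (mem S q))

  canAdd : Subset → Point → Bool
  canAdd S p = allP (λ q → not (q <ᵇ p) ∨ mem S q)

  toggled : Subset → Point → Bool
  toggled S p = if mem S p then not (canRemove S p) else canAdd S p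

  mem-toggle-self : ∀ S p → mem (toggle p S) p ≡ toggled S p
  mem-toggle-self S p with mem S p in e | canRemove S p | canAdd S p
  ... | true  | true  | _     = mem-setAt-self S p false
  ... | true  | false | _     = e
  ... | false | _     | true  = mem-setAt-self S p true
  ... | false | _     | false = e

  mem-toggle-other : ∀ S {p q} → p ≢ q → mem (toggle p S) q ≡ mem S q
  mem-toggle-other S {p} p≢q with mem S p | canRemove S p | canAdd S p
  ... | true  | true  | _     = mem-setAt-other S false p≢q
  ... | true  | false | _     = refl
  ... | false | _     | true  = mem-setAt-other S true p≢q
  ... | false | _     | false = refl

  toggled≡ : ∀ {S p b r a} → mem S p ≡ b → canRemove S p ≡ r → canAdd S p ≡ a →
    toggled S p ≡ (if b then not r else a)
  toggled≡ refl refl refl = refl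

  toggled-∈ : ∀ {S p} → T (mem S p) → toggled S p ≡ not (canRemove S p)
  toggled-∈ {S} {p} p∈S = toggled≡ {S} {p} (T⇒≡true {mem S p} p∈S) refl refl

  toggled-∉ : ∀ {S p} → ¬ T (mem S p) → toggled S p ≡ canAdd S p
  toggled-∉ {S} {p} p∉S = toggled≡ {S} {p} (¬T⇒≡false {mem S p} p∉S) refl refl

  canAdd⁺ : ∀ {S p q} → T (canAdd S p) → q <ₚ p → T (mem S q)
  canAdd⁺ {S} {p} t q<p = T-⇒⁺ (allP⁺ (λ q → not (q <ᵇ p) ∨ mem S q) t _) (<ₚ⇒<ᵇ q<p)

  canAdd⁻ : ∀ {S p} → (∀ {q} → q <ₚ p → T (mem S q)) → T (canAdd S p)
  canAdd⁻ {S} {p} h = allP⁻ (λ q → not (q <ᵇ p) ∨ mem S q) λ q → T-⇒⁻ (h ∘ <ᵇ⇒<ₚ)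

  canRemove⁺ : ∀ {S p q} → T (canRemove S p) → p <ₚ q → ¬ T (mem S q)
  canRemove⁺ {S} {p} t p<q = T-not⁺ (T-⇒⁺ (allP⁺ (λ q → not (p <ᵇ q) ∨ not (mem S q)) t _) (<ₚ⇒<ᵇ p<q))

  canRemove⁻ : ∀ {S p} → (∀ {q} → p <ₚ q → ¬ T (mem S q)) → T (canRemove S p)
  canRemove⁻ {S} {p} h = allP⁻ (λ q → not (p <ᵇ q) ∨ not (mem S q)) λ q → T-⇒⁻ (T-not⁻ ∘ h ∘ <ᵇ⇒<ₚ)

  canAdd-blocked : ∀ {S p r} → r <ₚ p → ¬ T (mem S r) → canAdd S p ≡ false
  canAdd-blocked {S} {p} r<p r∉S = ¬T⇒≡false λ t → r∉S (canAdd⁺ {S} {p} t r<p)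

  canRemove-blocked : ∀ {S p r} → p <ₚ r → T (mem S r) → canRemove S p ≡ false
  canRemove-blocked {S} {p} p<r r∈S = ¬T⇒≡false λ t → canRemove⁺ {S} {p} t p<r r∈S

  canAdd-local : ∀ {S S′ p} → (∀ {q} → q <ₚ p → mem S q ≡ mem S′ q) → canAdd S p ≡ canAdd S′ p
  canAdd-local {p = p} h = allP-cong λ q → ⇒-cong (q <ᵇ p) (h ∘ <ᵇ⇒<ₚ)

  canRemove-local : ∀ {S S′ p} → (∀ {q} → p <ₚ q → mem S q ≡ mem S′ q) → canRemove S p ≡ canRemove S′ p
  canRemove-local {p = p} h = allP-cong λ q → ⇒-cong (p <ᵇ q) (cong not ∘ h ∘ <ᵇ⇒<ₚ)

  Ideal-canAdd : ∀ {S p} → IsIdeal S → T (mem S p) → T (canAdd S p)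
  Ideal-canAdd {S} {p} ideal p∈S = canAdd⁻ {S} {p} λ {q} q<p → Ideal-down {S} {q} {p} ideal (proj₁ q<p) p∈S

  Ideal-canRemove : ∀ {S p} → IsIdeal S → ¬ T (mem S p) → T (canRemove S p)
  Ideal-canRemove {S} {p} ideal p∉S =
    canRemove⁻ {S} {p} λ {q} p<q q∈S → p∉S (Ideal-down {S} {p} {q} ideal (proj₁ p<q) q∈S)

  toggle-ideal : ∀ p {S} → IsIdeal S → IsIdeal (toggle p S)
  toggle-ideal p {S} ideal a b a≤ᵇb b∈ with a ≟ₚ p | b ≟ₚ p
  ... | yes refl | yes refl = b∈
  ... | no a≢p   | yes refl
    = subst T (sym (mem-toggle-other S (a≢p ∘ sym))) (a∈S (T? (mem S p)))
    where
    a<p : a <ₚ p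
    a<p = ≤ᵇ⇒≤ₚ a≤ᵇb , a≢p
    p∈′ : T (toggled S p)
    p∈′ = subst T (mem-toggle-self S p) b∈
    a∈S : Dec (T (mem S p)) → T (mem S a)
    a∈S (yes p∈S) = Ideal-down {S} {a} {p} ideal (proj₁ a<p) p∈S
    a∈S (no p∉S)  = canAdd⁺ {S} {p} (subst T (toggled-∉ {S} {p} p∉S) p∈′) a<p
  ... | yes refl | no b≢p
    = subst T (sym (mem-toggle-self S p)) (subst T (sym (toggled-∈ {S} {p} p∈S))
        (T-not⁻ λ t → canRemove⁺ {S} {p} t p<b b∈S))
    where
    b∈S : T (mem S b)
    b∈S = subst T (mem-toggle-other S (b≢p ∘ sym)) b∈
    p<b : p <ₚ b
    p<b = ≤ᵇ⇒≤ₚ a≤ᵇb , b≢p ∘ sym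
    p∈S : T (mem S p)
    p∈S = Ideal-down {S} {p} {b} ideal (proj₁ p<b) b∈S
  ... | no a≢p   | no b≢p
    = subst T (sym (mem-toggle-other S (a≢p ∘ sym)))
        (ideal a b a≤ᵇb (subst T (mem-toggle-other S (b≢p ∘ sym)) b∈))

  toggled-twice : ∀ {S} p → IsIdeal S → toggled (toggle p S) p ≡ mem S p
  toggled-twice {S} p ideal = begin
    toggled (toggle p S) p
      ≡⟨ toggled≡ {toggle p S} {p} (mem-toggle-self S p)
           (canRemove-local {toggle p S} {S} {p} λ p<q → mem-toggle-other S (proj₂ p<q))
           (canAdd-local {toggle p S} {S} {p} λ q<p → mem-toggle-other S (proj₂ q<p ∘ sym)) ⟩
    (if toggled S p then not (canRemove S p) else canAdd S p)
      ≡⟨ if-twice (mem S p) (canRemove S p) (canAdd S p)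
           (Ideal-canAdd {S} {p} ideal) (Ideal-canRemove {S} {p} ideal) ⟩
    mem S p ∎
    where open ≡.≡-Reasoning

  toggle-involutive : ∀ p {S} → IsIdeal S → toggle p (toggle p S) ≡ S
  toggle-involutive p {S} ideal = Subset-ext-at p
    (trans (mem-toggle-self (toggle p S) p) (toggled-twice {S} p ideal))
    λ p≢q → trans (mem-toggle-other (toggle p S) p≢q) (mem-toggle-other S p≢q)

  toggle-fixed : ∀ {S} q → toggled S q ≡ mem S q → toggle q S ≡ S
  toggle-fixed {S} q e = Subset-ext-at q (trans (mem-toggle-self S q) e) (mem-toggle-other S)

  toggle-blocked-below : ∀ {S q r} → IsIdeal S → r <ₚ q → ¬ T (mem S r) → toggle q S ≡ S
  toggle-blocked-below {S} {q} {r} ideal r<q r∉S = toggle-fixed q (begin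
    toggled S q ≡⟨ toggled-∉ {S} {q} q∉S ⟩
    canAdd S q  ≡⟨ canAdd-blocked {S} {q} r<q r∉S ⟩
    false       ≡⟨ ¬T⇒≡false {mem S q} q∉S ⟨
    mem S q     ∎)
    where
    open ≡.≡-Reasoning
    q∉S : ¬ T (mem S q)
    q∉S = r∉S ∘ Ideal-down {S} {r} {q} ideal (proj₁ r<q)

  toggle-blocked-above : ∀ {S q r} → IsIdeal S → q <ₚ r → T (mem S r) → toggle q S ≡ S
  toggle-blocked-above {S} {q} {r} ideal q<r r∈S = toggle-fixed q (begin
    toggled S q         ≡⟨ toggled-∈ {S} {q} q∈S ⟩
    not (canRemove S q) ≡⟨ cong not (canRemove-blocked {S} {q} q<r r∈S) ⟩
    true                ≡⟨ T⇒≡true {mem S q} q∈S ⟨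
    mem S q             ∎)
    where
    open ≡.≡-Reasoning
    q∈S : T (mem S q)
    q∈S = Ideal-down {S} {q} {r} ideal (proj₁ q<r) r∈S

  _⋖_ : Point → Point → Set
  (i , j , k) ⋖ (i′ , j′ , k′) =
      (toℕ i′ ≡ suc (toℕ i) × j ≡ j′ × k ≡ k′)
    ⊎ (i ≡ i′ × toℕ j′ ≡ suc (toℕ j) × k ≡ k′)
    ⊎ (i ≡ i′ × j ≡ j′ × toℕ k′ ≡ suc (toℕ k))

  Adjacent : Point → Point → Set
  Adjacent p q = p ⋖ q ⊎ q ⋖ p

  Adjacent-sym : ∀ {p q} → Adjacent p q → Adjacent q p
  Adjacent-sym = Sum.swap

  ⋖⇒<ₚ : ∀ {p q} → p ⋖ q → p <ₚ q
  ⋖⇒<ₚ (inj₁ (e , refl , refl))        = (≤-step e , Fin.≤-refl , Fin.≤-refl) , λ { refl → ≢-step e refl }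
  ⋖⇒<ₚ (inj₂ (inj₁ (refl , e , refl))) = (Fin.≤-refl , ≤-step e , Fin.≤-refl) , λ { refl → ≢-step e refl }
  ⋖⇒<ₚ (inj₂ (inj₂ (refl , refl , e))) = (Fin.≤-refl , Fin.≤-refl , ≤-step e) , λ { refl → ≢-step e refl }

  cover-below : ∀ {p q} → p <ₚ q → ∃ λ r → p ⋖ r × r ≤ₚ q
  cover-below {i , j , k} {i′ , j′ , k′} ((a , b , c) , p≢q) with i F.≟ i′ | j F.≟ j′ | k F.≟ k′
  ... | no i≢i′ | _ | _ with i₁ , e , i₁≤i′ ← Fin-successor (Fin.≤∧≢⇒< a i≢i′) =
    (i₁ , j , k) , inj₁ (e , refl , refl) , i₁≤i′ , b , c
  ... | yes refl | no j≢j′ | _ with j₁ , e , j₁≤j′ ← Fin-successor (Fin.≤∧≢⇒< b j≢j′) =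
    (i , j₁ , k) , inj₂ (inj₁ (refl , e , refl)) , a , j₁≤j′ , c
  ... | yes refl | yes refl | no k≢k′ with k₁ , e , k₁≤k′ ← Fin-successor (Fin.≤∧≢⇒< c k≢k′) =
    (i , j , k₁) , inj₂ (inj₂ (refl , refl , e)) , a , b , k₁≤k′
  ... | yes refl | yes refl | yes refl = ⊥-elim (p≢q refl)

  between : ∀ {p q} → p <ₚ q → ¬ p ⋖ q → ∃ λ r → p <ₚ r × r <ₚ q
  between p<q p⋖̸q with r , p⋖r , r≤q ← cover-below p<q = r , ⋖⇒<ₚ p⋖r , r≤q , λ { refl → p⋖̸q p⋖r }

  <ₚ-asym : ∀ {p q} → p <ₚ q → ¬ q <ₚ p
  <ₚ-asym = Strict.<-asym _≡_ _≤ₚ_ ≤ₚ-antisym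

  module _ {S : Subset} {p q : Point} where

    private
      toggled-toggle≡ : q ≢ p → canRemove (toggle q S) p ≡ canRemove S p → canAdd (toggle q S) p ≡ canAdd S p →
        toggled (toggle q S) p ≡ toggled S p
      toggled-toggle≡ q≢p = toggled≡ {toggle q S} {p} (mem-toggle-other S q≢p)

    toggled-toggle-incomparable : p ≢ q → ¬ p <ₚ q → ¬ q <ₚ p → toggled (toggle q S) p ≡ toggled S p
    toggled-toggle-incomparable p≢q p≮q q≮p = toggled-toggle≡ (p≢q ∘ sym)
      (canRemove-local {toggle q S} {S} {p} λ p<s → mem-toggle-other S λ { refl → p≮q p<s })
      (canAdd-local {toggle q S} {S} {p} λ s<p → mem-toggle-other S λ { refl → q≮p s<p })

    toggled-toggle-above : IsIdeal S → p <ₚ q → ¬ p ⋖ q → toggled (toggle q S) p ≡ toggled S p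
    toggled-toggle-above ideal p<q p⋖̸q with r , p<r , r<q ← between p<q p⋖̸q | T? (mem S r)
    ... | no r∉S  rewrite toggle-blocked-below {S} {q} {r} ideal r<q r∉S = refl
    ... | yes r∈S = toggled-toggle≡ (proj₂ p<q ∘ sym)
      (trans (canRemove-blocked {toggle q S} {p} p<r (subst T (sym (mem-toggle-other S (proj₂ r<q ∘ sym))) r∈S))
             (sym (canRemove-blocked {S} {p} p<r r∈S)))
      (canAdd-local {toggle q S} {S} {p} λ s<p → mem-toggle-other S λ { refl → <ₚ-asym p<q s<p })

    toggled-toggle-below : IsIdeal S → q <ₚ p → ¬ q ⋖ p → toggled (toggle q S) p ≡ toggled S p
    toggled-toggle-below ideal q<p q⋖̸p with r , q<r , r<p ← between q<p q⋖̸p | T? (mem S r)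
    ... | yes r∈S rewrite toggle-blocked-above {S} {q} {r} ideal q<r r∈S = refl
    ... | no r∉S  = toggled-toggle≡ (proj₂ q<p)
      (canRemove-local {toggle q S} {S} {p} λ p<s → mem-toggle-other S λ { refl → <ₚ-asym q<p p<s })
      (trans (canAdd-blocked {toggle q S} {p} r<p (subst (¬_ ∘ T) (sym (mem-toggle-other S (proj₂ q<r))) r∉S))
             (sym (canAdd-blocked {S} {p} r<p r∉S)))

    toggled-toggle : IsIdeal S → p ≢ q → ¬ Adjacent p q → toggled (toggle q S) p ≡ toggled S p
    toggled-toggle ideal p≢q p≁q with p <?ₚ q | q <?ₚ p
    ... | yes p<q | _       = toggled-toggle-above ideal p<q (p≁q ∘ inj₁)
    ... | no _    | yes q<p = toggled-toggle-below ideal q<p (p≁q ∘ inj₂)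
    ... | no p≮q  | no q≮p  = toggled-toggle-incomparable p≢q p≮q q≮p

  toggle-comm : ∀ {p q S} → ¬ Adjacent p q → IsIdeal S → toggle p (toggle q S) ≡ toggle q (toggle p S)
  toggle-comm {p} {q} {S} p≁q ideal with p ≟ₚ q
  ... | yes refl = refl
  ... | no p≢q   = Subset-ext λ r → agree r (p ≟ₚ r) (q ≟ₚ r)
    where
    open ≡.≡-Reasoning
    agree : ∀ r → Dec (p ≡ r) → Dec (q ≡ r) → mem (toggle p (toggle q S)) r ≡ mem (toggle q (toggle p S)) r
    agree _ (yes refl) _ = begin
      mem (toggle p (toggle q S)) p ≡⟨ mem-toggle-self (toggle q S) p ⟩
      toggled (toggle q S) p       ≡⟨ toggled-toggle {S} ideal p≢q p≁q ⟩
      toggled S p                  ≡⟨ mem-toggle-self S p ⟨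
      mem (toggle p S) p           ≡⟨ mem-toggle-other (toggle p S) (p≢q ∘ sym) ⟨
      mem (toggle q (toggle p S)) p ∎
    agree _ _ (yes refl) = begin
      mem (toggle p (toggle q S)) q ≡⟨ mem-toggle-other (toggle q S) p≢q ⟩
      mem (toggle q S) q           ≡⟨ mem-toggle-self S q ⟩
      toggled S q                  ≡⟨ toggled-toggle {S} ideal (p≢q ∘ sym) (p≁q ∘ Adjacent-sym) ⟨
      toggled (toggle p S) q       ≡⟨ mem-toggle-self (toggle p S) q ⟨
      mem (toggle q (toggle p S)) q ∎
    agree r (no p≢r) (no q≢r) = begin
      mem (toggle p (toggle q S)) r ≡⟨ mem-toggle-other (toggle q S) p≢r ⟩
      mem (toggle q S) r           ≡⟨ mem-toggle-other S q≢r ⟩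
      mem S r                      ≡⟨ mem-toggle-other S p≢r ⟨
      mem (toggle p S) r           ≡⟨ mem-toggle-other (toggle p S) q≢r ⟨
      mem (toggle q (toggle p S)) r ∎

  open Words (toggle {ℓ} {m} {n}) using (run; run-++)
  open Words.Preserving (toggle {ℓ} {m} {n}) IsIdeal toggle-ideal public using (run-Inv)
  open Words.Preserving.Involutive (toggle {ℓ} {m} {n}) IsIdeal toggle-ideal toggle-involutive
    public using (run-injective; run-surjective)
  open Words.Preserving.Commuting (toggle {ℓ} {m} {n}) IsIdeal toggle-ideal Adjacent Adjacent-sym
    (λ {p} {q} {S} → toggle-comm {p} {q} {S})
    using (OrderedBy; sorted⇒orderedBy; run-reorder)

  -- Rowmotion as a product of toggles

  mem-row : ∀ (I : Subset) p → mem (row I) p ≡ anyP (λ q → minCompl I q ∧ (p ≤ᵇ q))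
  mem-row I (i , j , k) =
    trans (cong (λ v → lookup (lookup v j) k) (lookup∘tabulate _ i))
      (trans (cong (λ v → lookup v k) (lookup∘tabulate _ j)) (lookup∘tabulate _ k))

  row⁺ : ∀ {I : Subset} {p} → T (mem (row I) p) → ∃ λ q → ¬ T (mem I q) × T (canAdd I q) × p ≤ₚ q
  row⁺ {I} {p} p∈ with q , t ← anyP⁺ (subst T (mem-row I p) p∈)
                   with min , p≤q ← Equivalence.to (Bool.T-∧ {minCompl I q}) t
                   with q∉I , q-min ← Equivalence.to (Bool.T-∧ {not (mem I q)}) min =
    q , T-not⁺ q∉I , q-min , ≤ᵇ⇒≤ₚ p≤q

  row⁻ : ∀ {I : Subset} {p q} → ¬ T (mem I q) → T (canAdd I q) → p ≤ₚ q → T (mem (row I) p)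
  row⁻ {I} {p} {q} q∉I q-min p≤q = subst T (sym (mem-row I p)) (anyP⁻ q
    (Equivalence.from Bool.T-∧ (Equivalence.from Bool.T-∧ (T-not⁻ q∉I , q-min) , ≤ₚ⇒≤ᵇ p≤q)))

  row-∈ : ∀ {I : Subset} {p} → T (mem I p) → mem (row I) p ≡ not (canRemove (row I) p)
  row-∈ {I} {p} p∈I = T-ext-not p∈R⇒blocked p∉R⇒removable
    where
    p∈R⇒blocked : T (mem (row I) p) → ¬ T (canRemove (row I) p)
    p∈R⇒blocked p∈R t = let q , q∉I , q-min , p≤q = row⁺ {I} p∈R in
      canRemove⁺ {row I} {p} t (p≤q , λ p≡q → q∉I (subst (T ∘ mem I) p≡q p∈I))
        (row⁻ {I} q∉I q-min ≤ₚ-refl)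
    p∉R⇒removable : ¬ T (mem (row I) p) → T (canRemove (row I) p)
    p∉R⇒removable p∉R = canRemove⁻ {row I} {p} λ p<q q∈R →
      let r , r∉I , r-min , q≤r = row⁺ {I} q∈R in p∉R (row⁻ {I} r∉I r-min (≤ₚ-trans (proj₁ p<q) q≤r))

  row-∉ : ∀ {I : Subset} {p} → ¬ T (mem I p) → mem (row I) p ≡ canAdd I p
  row-∉ {I} {p} p∉I = T-ext p∈R⇒minimal λ p-min → row⁻ {I} {p} {p} p∉I p-min ≤ₚ-refl
    where
    p∈R⇒minimal : T (mem (row I) p) → T (canAdd I p)
    p∈R⇒minimal p∈R = let q , q∉I , q-min , p≤q = row⁺ {I} p∈R in case p ≟ₚ q of λ where
      (yes p≡q)  → subst (T ∘ canAdd I) (sym p≡q) q-min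
      (no p≢q)   → ⊥-elim (p∉I (canAdd⁺ {I} {q} q-min (p≤q , p≢q)))

  Enumerates : List Point → Set
  Enumerates w = Unique w × (∀ p → p ∈ w)

  TopDown : List Point → Set
  TopDown = AllPairs (λ a b → ¬ a <ₚ b)

  run-topDown : ∀ (I : Subset) rest {S} → Unique rest → TopDown rest →
    (∀ {q r} → q <ₚ r → r ∈ rest → q ∈ rest) →
    (∀ {q} → q ∈ rest → mem S q ≡ mem I q) → (∀ {q} → q ∉ rest → mem S q ≡ mem (row I) q) →
    run rest S ≡ row I
  run-topDown I []         _ _ _ _ off = Subset-ext λ q → off λ ()
  run-topDown I (p ∷ rest) {S} (p∉rest ∷ rest!) (p≮rest ∷ topDown) downClosed on off =
    run-topDown I rest rest! topDown downClosed′ on′ off′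
    where
    open ≡.≡-Reasoning
    not-above : ∀ {q} → p <ₚ q → q ∉ p ∷ rest
    not-above p<q (here refl)  = Strict.<-irrefl _≡_ _≤ₚ_ refl p<q
    not-above p<q (there q∈)   = All.lookup p≮rest q∈ p<q
    -- The points above p already carry their value in row I, those below p still that in I.
    p-done : toggled S p ≡ mem (row I) p
    p-done with T? (mem I p)
    ... | yes p∈I = begin
      toggled S p         ≡⟨ toggled-∈ {S} {p} (subst T (sym (on (here refl))) p∈I) ⟩
      not (canRemove S p) ≡⟨ cong not (canRemove-local {S} {row I} {p} λ p<q → off (not-above p<q)) ⟩
      not (canRemove (row I) p) ≡⟨ row-∈ {I} p∈I ⟨
      mem (row I) p       ∎
    ... | no p∉I = begin
      toggled S p         ≡⟨ toggled-∉ {S} {p} (p∉I ∘ subst T (on (here refl))) ⟩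
      canAdd S p          ≡⟨ canAdd-local {S} {I} {p} (λ q<p → on (downClosed q<p (here refl))) ⟩
      canAdd I p          ≡⟨ row-∉ {I} p∉I ⟨
      mem (row I) p       ∎
    downClosed′ : ∀ {q r} → q <ₚ r → r ∈ rest → q ∈ rest
    downClosed′ q<r r∈ with downClosed q<r (there r∈)
    ... | here refl = ⊥-elim (All.lookup p≮rest r∈ q<r)
    ... | there q∈  = q∈
    on′ : ∀ {q} → q ∈ rest → mem (toggle p S) q ≡ mem I q
    on′ q∈ = trans (mem-toggle-other S (All.lookup p∉rest q∈)) (on (there q∈))
    off′ : ∀ {q} → q ∉ rest → mem (toggle p S) q ≡ mem (row I) q
    off′ {q} q∉ with p ≟ₚ q
    ... | yes refl = trans (mem-toggle-self S p) p-done
    ... | no p≢q   = trans (mem-toggle-other S p≢q) (off λ { (here refl) → p≢q refl ; (there q∈) → q∉ q∈ })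

  row-as-run : ∀ I {w} → Enumerates w → TopDown w → run w I ≡ row I
  row-as-run I (w! , complete) topDown =
    run-topDown I _ w! topDown (λ _ _ → complete _) (λ _ → refl) (λ q∉ → ⊥-elim (q∉ (complete _)))

  run-enumerations : ∀ K {w₁ w₂ S} → Enumerates w₁ → Enumerates w₂ →
    OrderedBy K w₁ → OrderedBy K w₂ → IsIdeal S → run w₁ S ≡ run w₂ S
  run-enumerations K (w₁! , all₁) (w₂! , all₂) o₁ o₂ =
    run-reorder K w₁! w₂! (λ _ → all₂ _) (λ _ → all₁ _) o₁ o₂

  -- From rowmotion to promotion

  height depth rank : Point → ℕ
  height (i , _ , k) = toℕ i + toℕ k
  depth  (_ , j , _) = toℕ j
  rank p = height p + depth p

  key : ℕ → Point → ℤ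
  key s p = keyOf s (height p) (depth p)

  ⋖-shape : ∀ {p q} → p ⋖ q →
    (height q ≡ suc (height p) × depth q ≡ depth p) ⊎ (height q ≡ height p × depth q ≡ suc (depth p))
  ⋖-shape {i , _ , k} (inj₁ (e , refl , refl))        = inj₁ (cong (_+ toℕ k) e , refl)
  ⋖-shape             (inj₂ (inj₁ (refl , e , refl))) = inj₂ (refl , e)
  ⋖-shape {i , _ , k} (inj₂ (inj₂ (refl , refl , e))) =
    inj₁ (trans (cong (λ c → toℕ i + c) e) (Nat.+-suc (toℕ i) (toℕ k)) , refl)

  rank-⋖ : ∀ {p q} → p ⋖ q → rank q ≡ suc (rank p)
  rank-⋖ {p} p⋖q with ⋖-shape p⋖q
  ... | inj₁ (eh , ed) = cong₂ _+_ eh ed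
  ... | inj₂ (eh , ed) = trans (cong₂ _+_ eh ed) (Nat.+-suc (height p) (depth p))

  rank-mono : ∀ {p q} → p ≤ₚ q → rank p ≤ rank q
  rank-mono (a , b , c) = Nat.+-mono-≤ (Nat.+-mono-≤ a c) b

  rank-< : ∀ {p q} → p <ₚ q → rank p < rank q
  rank-< p<q with r , p⋖r , r≤q ← cover-below p<q =
    Nat.≤-trans (Nat.≤-reflexive (sym (rank-⋖ p⋖r))) (rank-mono r≤q)

  key-zero-antitone : ∀ {p q} → p <ₚ q → key 0 q <ℤ key 0 p
  key-zero-antitone {p} {q} p<q =
    subst₂ _<ℤ_ (sym (keyOf-zero (height q) (depth q))) (sym (keyOf-zero (height p) (depth p)))
      (ℤ.⊖-monoʳ->-< 1 (rank-< p<q))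

  key-separated : ∀ s {p q} → Adjacent p q → key s p ≢ key s q
  key-separated s (inj₁ p⋖q) = keyOf-step-≢ s (⋖-shape p⋖q)
  key-separated s (inj₂ q⋖p) = keyOf-step-≢ s (⋖-shape q⋖p) ∘ sym

  adjacent-across : ∀ {s p q} → Adjacent p q → height p ≤ s → s < height q →
    height q ≡ suc (height p) × depth q ≡ depth p
  adjacent-across {s} (inj₁ p⋖q) hp≤s s<hq with ⋖-shape p⋖q
  ... | inj₁ up       = up
  ... | inj₂ (eh , _) = ⊥-elim (Nat.<⇒≱ s<hq (subst (_≤ s) (sym eh) hp≤s))
  adjacent-across {s} {q = q} (inj₂ q⋖p) hp≤s s<hq with ⋖-shape q⋖p
  ... | inj₁ (eh , _) = ⊥-elim (Nat.<⇒≱ (Nat.<-trans s<hq (subst (height q <_) (sym eh) (Nat.n<1+n _))) hp≤s)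
  ... | inj₂ (eh , _) = ⊥-elim (Nat.<⇒≱ s<hq (subst (_≤ s) eh hp≤s))

  key-across : ∀ {s p q} → Adjacent p q → height p ≤ s → s < height q →
    key (suc s) p <ℤ key (suc s) q × key s q <ℤ key s p
  key-across {s} {p} {q} p∼q hp≤s s<hq with eh , ed ← adjacent-across p∼q hp≤s s<hq =
    subst₂ (λ h y → key (suc s) p <ℤ keyOf (suc s) h y) (sym eh) (sym ed)
      (keyOf-suc-h-below (depth p) (s≤s hp≤s)) ,
    subst₂ (λ h y → keyOf s h y <ℤ key s p) (sym eh) (sym ed)
      (keyOf-suc-h-above (depth p) (Nat.≤-pred (subst (s <_) eh s<hq)))

  N : ℕ
  N = ℓ + m + n

  rank≤N : ∀ p → rank p ≤ N
  rank≤N p@(i , j , k) = subst (rank p ≤_) (arith ℓ m n)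
    (Nat.+-mono-≤ (Nat.+-mono-≤ (Nat.<⇒≤ (Fin.toℕ<n i)) (Nat.<⇒≤ (Fin.toℕ<n k))) (Nat.<⇒≤ (Fin.toℕ<n j)))
    where
    arith : ∀ a b c → a + c + b ≡ a + b + c
    arith = solve-∀

  sweepStart : ℤ
  sweepStart = 0 ⊖ N

  sweepLength : ℕ
  sweepLength = 3 * N + 2

  sweep : ℕ → List Point
  sweep s = Levels.levels (key s) points sweepStart sweepLength

  sweep-enumerates : ∀ s → Enumerates (sweep s)
  sweep-enumerates s = Levels.levels-unique (key s) points points-unique sweepStart sweepLength , λ p →
    Levels.∈-levels (key s) points sweepStart sweepLength (∈-points p) (lower p) (upper p)
    where
    A : Point → ℕ
    A p = 2 * (height p ⊓ s) + 1
    A≤ : ∀ p → A p ≤ 2 * N + 1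
    A≤ p = Nat.+-monoˡ-≤ 1 (Nat.*-monoʳ-≤ 2
      (Nat.≤-trans (Nat.m⊓n≤m (height p) s) (Nat.≤-trans (Nat.m≤m+n (height p) (depth p)) (rank≤N p))))
    lower : ∀ p → sweepStart ≤ℤ key s p
    lower p = ⊖-≤-⊖ {0} {N} {A p} {rank p} (Nat.≤-trans (rank≤N p) (Nat.m≤n+m N (A p)))
    arith : ∀ N → suc (2 * N + 1 + N) ≡ 3 * N + 2
    arith = solve-∀
    upper : ∀ p → key s p <ℤ sweepStart +ℤ + sweepLength
    upper p = subst (key s p <ℤ_) (sym (ℤ.distribˡ-⊖-+-pos sweepLength 0 N))
      (⊖-<-⊖ {A p} {rank p} {sweepLength} {N}
        (Nat.≤-trans (s≤s (Nat.+-monoˡ-≤ N (A≤ p)))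
          (Nat.≤-trans (Nat.≤-reflexive (arith N)) (Nat.m≤m+n sweepLength (rank p)))))

  sweep-ordered : ∀ s → OrderedBy (key s) (sweep s)
  sweep-ordered s = sorted⇒orderedBy (key s) (key-separated s) (Levels.levels-sorted (key s) points sweepStart sweepLength)

  sweep-zero-topDown : TopDown (sweep 0)
  sweep-zero-topDown = AllPairs.map (λ ≤K a<b → ℤ.<⇒≱ (key-zero-antitone a<b) ≤K)
    (Levels.levels-sorted (key 0) points sweepStart sweepLength)

  upperPart lowerPart : ℕ → List Point
  upperPart s = filter (λ p → s Nat.<? height p) (sweep s)
  lowerPart s = filter (λ p → height p Nat.≤? s) (sweep s)

  module _ (s : ℕ) where

    private
      ∈-upper⁻ : ∀ {p} → p ∈ upperPart s → s < height p
      ∈-upper⁻ = proj₂ ∘ ∈-filter⁻ (λ p → s Nat.<? height p) {xs = sweep s}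

      ∈-lower⁻ : ∀ {p} → p ∈ lowerPart s → height p ≤ s
      ∈-lower⁻ = proj₂ ∘ ∈-filter⁻ (λ p → height p Nat.≤? s) {xs = sweep s}

      upper-unique : Unique (upperPart s)
      upper-unique = Unique.filter⁺ (λ p → s Nat.<? height p) (proj₁ (sweep-enumerates s))

      lower-unique : Unique (lowerPart s)
      lower-unique = Unique.filter⁺ (λ p → height p Nat.≤? s) (proj₁ (sweep-enumerates s))

      disjoint : ∀ {p} → p ∈ upperPart s → p ∈ lowerPart s → ⊥
      disjoint p∈u p∈l = Nat.<⇒≱ (∈-upper⁻ p∈u) (∈-lower⁻ p∈l)

      upper-or-lower : ∀ p → p ∈ upperPart s ⊎ p ∈ lowerPart s
      upper-or-lower p with s Nat.<? height p
      ... | yes s<h = inj₁ (∈-filter⁺ (λ p → s Nat.<? height p) (proj₂ (sweep-enumerates s) p) s<h)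
      ... | no s≮h  = inj₂ (∈-filter⁺ (λ p → height p Nat.≤? s) (proj₂ (sweep-enumerates s) p) (Nat.≮⇒≥ s≮h))

      upper-ordered : OrderedBy (key s) (upperPart s)
      upper-ordered = AllPairs.filter⁺ (λ p → s Nat.<? height p) (sweep-ordered s)

      lower-ordered : OrderedBy (key s) (lowerPart s)
      lower-ordered = AllPairs.filter⁺ (λ p → height p Nat.≤? s) (sweep-ordered s)

    upper++lower-enumerates : Enumerates (upperPart s ++ lowerPart s)
    upper++lower-enumerates =
      Unique.++⁺ upper-unique lower-unique (λ (p∈u , p∈l) → disjoint p∈u p∈l) ,
      λ p → Sum.[ ∈-++⁺ˡ , ∈-++⁺ʳ (upperPart s) ]′ (upper-or-lower p)

    lower++upper-enumerates : Enumerates (lowerPart s ++ upperPart s)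
    lower++upper-enumerates =
      Unique.++⁺ lower-unique upper-unique (λ (p∈l , p∈u) → disjoint p∈u p∈l) ,
      λ p → Sum.[ ∈-++⁺ʳ (lowerPart s) , ∈-++⁺ˡ ]′ (upper-or-lower p)

    upper++lower-ordered : OrderedBy (key s) (upperPart s ++ lowerPart s)
    upper++lower-ordered = AllPairs.++⁺ upper-ordered lower-ordered
      (All.tabulate λ p∈u → All.tabulate λ q∈l p∼q →
        proj₂ (key-across (Adjacent-sym p∼q) (∈-lower⁻ q∈l) (∈-upper⁻ p∈u)))

    lower++upper-ordered : OrderedBy (key (suc s)) (lowerPart s ++ upperPart s)
    lower++upper-ordered = AllPairs.++⁺
      (AllPairs-mapWithin (λ hp≤s hq≤s ord p∼q →
          subst₂ _<ℤ_ (sym (keyOf-suc-s-below _ hp≤s)) (sym (keyOf-suc-s-below _ hq≤s)) (ord p∼q))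
        (All.all-filter (λ p → height p Nat.≤? s) (sweep s)) lower-ordered)
      (AllPairs-mapWithin (λ s<hp s<hq ord p∼q →
          subst₂ _<ℤ_ (sym (keyOf-suc-s-above _ s<hp)) (sym (keyOf-suc-s-above _ s<hq)) (ℤ.+-monoˡ-< (+ 2) (ord p∼q)))
        (All.all-filter (λ p → s Nat.<? height p) (sweep s)) upper-ordered)
      (All.tabulate λ p∈l → All.tabulate λ q∈u p∼q →
        proj₁ (key-across p∼q (∈-lower⁻ p∈l) (∈-upper⁻ q∈u)))

  conjugatingWord : ℕ → List Point
  conjugatingWord zero    = []
  conjugatingWord (suc s) = conjugatingWord s ++ upperPart s

  conjugate : ℕ → Subset → Subset
  conjugate s = run (conjugatingWord s)

  conjugate-row : ∀ s {I} → IsIdeal I → conjugate s (row I) ≡ run (sweep s) (conjugate s I)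
  conjugate-row zero    {I} ideal = sym (row-as-run I (sweep-enumerates 0) sweep-zero-topDown)
  conjugate-row (suc s) {I} ideal = begin
    run (conjugatingWord s ++ U) (row I)      ≡⟨ run-++ (conjugatingWord s) U (row I) ⟩
    run U (conjugate s (row I))               ≡⟨ cong (run U) (conjugate-row s ideal) ⟩
    run U (run (sweep s) X)                   ≡⟨ cong (run U) (run-enumerations (key s)
                                                   (sweep-enumerates s) (upper++lower-enumerates s)
                                                   (sweep-ordered s) (upper++lower-ordered s) X-ideal) ⟩
    run U (run (U ++ L) X)                    ≡⟨ cong (run U) (run-++ U L X) ⟩
    run U (run L (run U X))                   ≡⟨ run-++ L U (run U X) ⟨
    run (L ++ U) (run U X)                    ≡⟨ run-enumerations (key (suc s))
                                                   (lower++upper-enumerates s) (sweep-enumerates (suc s))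
                                                   (lower++upper-ordered s) (sweep-ordered (suc s)) (run-Inv U X-ideal) ⟩
    run (sweep (suc s)) (run U X)             ≡⟨ cong (run (sweep (suc s))) (run-++ (conjugatingWord s) U I) ⟨
    run (sweep (suc s)) (conjugate (suc s) I) ∎
    where
    open ≡.≡-Reasoning
    U L : List Point
    U = upperPart s
    L = lowerPart s
    X : Subset
    X = conjugate s I
    X-ideal : IsIdeal X
    X-ideal = run-Inv (conjugatingWord s) ideal

  -- col t is definitionally run (Levels.level label points t).
  proAux-run : ∀ r t S → proAux r t S ≡ run (Levels.levels label points t r) S
  proAux-run zero    t S = refl
  proAux-run (suc r) t S =
    trans (proAux-run r (t +ℤ + 1) (col t S)) (sym (run-++ (Levels.level label points t) _ S))

  2+height≤ : ∀ p → 2 + height p ≤ ℓ + n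
  2+height≤ (i , _ , k) =
    subst (_≤ ℓ + n) (cong suc (Nat.+-suc (toℕ i) (toℕ k))) (Nat.+-mono-≤ (Fin.toℕ<n i) (Fin.toℕ<n k))

  label-⊖ : ∀ p → label p ≡ (2 + height p) ⊖ suc (depth p)
  label-⊖ (i , j , k) = begin
    + suc x ℤ.- + suc y +ℤ + suc z ≡⟨ cong (_+ℤ + suc z) (ℤ.[+m]-[+n]≡m⊖n (suc x) (suc y)) ⟩
    (suc x ⊖ suc y) +ℤ + suc z     ≡⟨ ℤ.distribˡ-⊖-+-pos (suc z) (suc x) (suc y) ⟩
    (suc x + suc z) ⊖ suc y        ≡⟨ cong (λ c → suc c ⊖ suc y) (Nat.+-suc x z) ⟩
    (2 + (x + z)) ⊖ suc y          ∎
    where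
    open ≡.≡-Reasoning
    x = toℕ i
    y = toℕ j
    z = toℕ k

  label-key : ∀ p → label p ≡ key (ℓ + n) p
  label-key p = begin
    label p                                ≡⟨ label-⊖ p ⟩
    (2 + h) ⊖ suc y                        ≡⟨ ⊖-≡-⊖ {2 + h} {suc y} {2 * h + 1} {h + y} (arith h y) ⟩
    (2 * h + 1) ⊖ (h + y)                  ≡⟨ cong (λ c → (2 * c + 1) ⊖ (h + y)) (Nat.m≤n⇒m⊓n≡m h≤) ⟨
    (2 * (h ⊓ (ℓ + n)) + 1) ⊖ (h + y)      ∎
    where
    open ≡.≡-Reasoning
    h = height p
    y = depth p
    h≤ : h ≤ ℓ + n
    h≤ = Nat.≤-trans (Nat.m≤n+m h 2) (2+height≤ p)
    arith : ∀ h y → (2 + h) + (h + y) ≡ (2 * h + 1) + suc y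
    arith = solve-∀

  proStart : ℤ
  proStart = + 2 ℤ.- + m

  proLength : ℕ
  proLength = ℓ + m + n ∸ 2

  proWord : List Point
  proWord = Levels.levels label points proStart proLength

  proWord-enumerates : Enumerates proWord
  proWord-enumerates = Levels.levels-unique label points points-unique proStart proLength , λ p →
    Levels.∈-levels label points proStart proLength (∈-points p) (lower p) (upper p)
    where
    start : proStart ≡ 2 ⊖ m
    start = ℤ.[+m]-[+n]≡m⊖n 2 m
    lower : ∀ p → proStart ≤ℤ label p
    lower p@(_ , j , _) = subst₂ _≤ℤ_ (sym start) (sym (label-⊖ p))
      (⊖-≤-⊖ {2} {m} {2 + height p} {suc (depth p)}
        (Nat.≤-trans (Nat.+-monoʳ-≤ 2 (Fin.toℕ<n j)) (Nat.+-monoˡ-≤ m (Nat.m≤m+n 2 (height p)))))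
    arith : ∀ a b c → a + c + b ≡ a + b + c
    arith = solve-∀
    upper : ∀ p → label p <ℤ proStart +ℤ + proLength
    upper p = subst₂ _<ℤ_ (sym (label-⊖ p)) (sym end)
      (⊖-<-⊖ {2 + height p} {suc (depth p)} {ℓ + m + n} {m}
        (Nat.≤-<-trans (Nat.≤-trans (Nat.+-monoˡ-≤ m (2+height≤ p)) (Nat.≤-reflexive (arith ℓ m n)))
          (Nat.m<m+n (ℓ + m + n) (s≤s z≤n))))
      where
      2≤ : 2 ≤ ℓ + m + n
      2≤ = Nat.≤-trans (Nat.m≤m+n 2 (height p))
        (Nat.≤-trans (2+height≤ p) (Nat.≤-trans (Nat.m≤m+n (ℓ + n) m) (Nat.≤-reflexive (arith ℓ m n))))
      end : proStart +ℤ + proLength ≡ (ℓ + m + n) ⊖ m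
      end = trans (cong (_+ℤ + proLength) start)
        (trans (ℤ.distribˡ-⊖-+-pos proLength 2 m) (cong (_⊖ m) (Nat.m+[n∸m]≡n 2≤)))

  proWord-ordered : OrderedBy (key (ℓ + n)) proWord
  proWord-ordered = sorted⇒orderedBy (key (ℓ + n)) (key-separated (ℓ + n))
    (AllPairs.map (λ {a} {b} → subst₂ _≤ℤ_ (label-key a) (label-key b))
      (Levels.levels-sorted label points proStart proLength))

  pro-sweep : ∀ {S} → IsIdeal S → pro S ≡ run (sweep (ℓ + n)) S
  pro-sweep {S} ideal = trans (proAux-run proLength proStart S)
    (run-enumerations (key (ℓ + n)) proWord-enumerates (sweep-enumerates (ℓ + n))
      proWord-ordered (sweep-ordered (ℓ + n)) ideal)

corollary7p2 : (ℓ m n : ℕ) → 1 ≤ ℓ → 1 ≤ m → 1 ≤ n →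
    Σ (Sub ℓ m n → Sub ℓ m n) λ Φ →
      (∀ I → IsIdeal I → IsIdeal (Φ I))
      × (∀ I J → IsIdeal I → IsIdeal J → Φ I ≡ Φ J → I ≡ J)
      × (∀ J → IsIdeal J → Σ (Sub ℓ m n) λ I → IsIdeal I × Φ I ≡ J)
      × (∀ I → IsIdeal I → Φ (row I) ≡ pro (Φ I))
corollary7p2 ℓ m n _ _ _ =
  conjugate (ℓ + n) ,
  (λ I → run-Inv (conjugatingWord (ℓ + n))) ,
  (λ I J → run-injective (conjugatingWord (ℓ + n))) ,
  (λ J → run-surjective (conjugatingWord (ℓ + n))) ,
  λ I ideal → trans (conjugate-row (ℓ + n) ideal) (sym (pro-sweep (run-Inv (conjugatingWord (ℓ + n)) ideal)))
  where open Box ℓ m n
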